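{- Let $n\ge 2$. The set $\mathcal{F}^{1}_{n,2}$ is in bijection with the set $\mathcal{K}_{n-1}$ of kagog triangles of index $n-1$.
   Context: Let $[n]=\{1,\ldots,n\}$. The ground set of the poset $F_{n,2}$ consists of $\emptyset$ and all subsets of $[n]$ of size $1$ or $2$. Identify each nonempty such set $S$ with the pair $(a,b)$, where $a=\max S$ and $b$ is the other element of $S$ if $|S|=2$ and $b=0$ if $|S|=1$. The order of $F_{n,2}$: $\emptyset$ is the minimum, and $(a,b)\preceq(c,d)$ iff $a\le c$ and $b\le d$. A refinement of a poset is a partial order on the same ground set whose order relation contains the original one. $\mathcal{F}^{1}_{n,2}$ is the set of partial orders $P$ on the ground set of $F_{n,2}$ such that (i) $P$ refines $F_{n,2}$, (ii) every singleton set $\{i\}$ is comparable in $P$ with every element, and (iii) $P$ is minimal with respect to inclusion of order relations among all partial orders satisfying (i) and (ii). A kagog triangle of index $m$ is an array of nonnegative integers $K(i,j)$, $1\le j\le i\le m-1$ (the empty array when $m=1$), such that: $0\le K(i,j)\le j$; $K(i,j)\ge K(i+1,j)$ whenever both are defined (columns weakly decreasing); and if $K(i,j)>0$ and $j<i$ then $K(i,j+1)>K(i,j)$ (each row is a run of zeros followed by strictly increasing positive entries). $\mathcal{K}_m$ denotes the set of kagog triangles of index $m$. -}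

module Defs where

open import Data.Nat using (ℕ; zero; suc; _≤_; _<_; _>_; _≥_)
open import Data.Bool using (Bool; true; false)
open import Data.Product using (Σ; _×_; _,_; proj₁; proj₂)
open import Data.Sum using (_⊎_)
open import Data.Unit using (⊤)
open import Relation.Binary.PropositionalEquality using (_≡_; refl; sym; trans)
open import Relation.Binary.Bundles using (Setoid)
open import Relation.Binary.Structures using (IsEquivalence)

-- Ground set of F_{n,2}: the empty set, and a nonempty set S ⊆ [n] with |S| ≤ 2
-- encoded as the pair (a , b) with a = max S, b = other element or 0.
-- Constraints: b < a ≤ n (hence 1 ≤ a).
data Gd (n : ℕ) : Set where
  emp  : Gd n
  pair : (a b : ℕ) → b < a → a ≤ n → Gd n

data _≼F_ {n : ℕ} : Gd n → Gd n → Set where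
  emp≼ : ∀ {x} → emp ≼F x
  pair≼ : ∀ {a b c d p q r s} → a ≤ c → b ≤ d → pair a b p q ≼F pair c d r s

Rel₂ : ℕ → Set
Rel₂ n = Gd n → Gd n → Bool

record IsPartialOrder {n : ℕ} (P : Rel₂ n) : Set where
  field
    refl'  : ∀ x → P x x ≡ true
    antisym : ∀ x y → P x y ≡ true → P y x ≡ true → x ≡ y
    trans' : ∀ x y z → P x y ≡ true → P y z ≡ true → P x z ≡ true

Refines : {n : ℕ} → Rel₂ n → Set
Refines {n} P = ∀ (x y : Gd n) → x ≼F y → P x y ≡ true

SingletonsComparable : {n : ℕ} → Rel₂ n → Set
SingletonsComparable {n} P =
  ∀ (i : ℕ) (p : 0 < i) (q : i ≤ n) (y : Gd n) →
    (P (pair i 0 p q) y ≡ true) ⊎ (P y (pair i 0 p q) ≡ true)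

_⊆R_ : {n : ℕ} → Rel₂ n → Rel₂ n → Set
_⊆R_ {n} P Q = ∀ (x y : Gd n) → P x y ≡ true → Q x y ≡ true

Admissible : {n : ℕ} → Rel₂ n → Set
Admissible P = IsPartialOrder P × Refines P × SingletonsComparable P

IsF1 : {n : ℕ} → Rel₂ n → Set
IsF1 {n} P = Admissible P × (∀ (Q : Rel₂ n) → Admissible Q → Q ⊆R P → P ⊆R Q)

F1Setoid : ℕ → Setoid _ _
F1Setoid n = record
  { Carrier = Σ (Rel₂ n) IsF1
  ; _≈_ = λ P Q → ∀ (x y : Gd n) → proj₁ P x y ≡ proj₁ Q x y
  ; isEquivalence = record
    { refl = λ x y → refl
    ; sym = λ e x y → sym (e x y)
    ; trans = λ e f x y → trans (e x y) (f x y) } }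

-- Kagog triangles of index m: arrays K(i,j), 1 ≤ j ≤ i ≤ m-1 (i.e. i < m),
-- represented by a function ℕ → ℕ → ℕ whose values outside the index range are ignored.
InDom : ℕ → ℕ → ℕ → Set
InDom m i j = 1 ≤ j × j ≤ i × i < m

record IsKagog (m : ℕ) (K : ℕ → ℕ → ℕ) : Set where
  field
    bound : ∀ i j → InDom m i j → K i j ≤ j
    colDecr : ∀ i j → InDom m i j → InDom m (suc i) j → K i j ≥ K (suc i) j
    rowIncr : ∀ i j → InDom m i j → K i j > 0 → j < i → K i (suc j) > K i j

KagogSetoid : ℕ → Setoid _ _
KagogSetoid m = record
  { Carrier = Σ (ℕ → ℕ → ℕ) (IsKagog m)
  ; _≈_ = λ K L → ∀ i j → InDom m i j → proj₁ K i j ≡ proj₁ L i j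
  ; isEquivalence = record
    { refl = λ i j d → refl
    ; sym = λ e i j d → sym (e i j d)
    ; trans = λ e f i j d → trans (e i j d) (f i j d) } }

module Submission where

-- For a singleton {i} and a set {b, a} with i ≤ a, the comparison {i} ⪯ {b, a}
-- is forced by F_{n,2}.  For i = r + 2 > a = j + 1 the b ∈ [1, j] with
-- {i} ⪯ {b, j + 1} form an up-set of [1, j], so they are determined by their
-- number K(r, j); transitivity through F_{n,2} makes the columns of K weakly
-- decreasing and every row strictly increasing once positive, i.e. K is a kagog
-- triangle.  Conversely, the comparisons prescribed by a kagog triangle generate
-- a partial order: a set lies below {i} exactly when {i} does not lie below it,
-- and two sets compare when they do in F_{n,2} or through a singleton.  It is the
-- least admissible order with these comparisons, so by minimality every member
-- of F¹ with triangle K equals it.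

open import Defs
open import Data.Bool using (Bool; true; false; if_then_else_)
open import Data.Bool.Properties using (⇔→≡)
open import Data.Empty using (⊥)
open import Data.Nat
  using (ℕ; zero; suc; _+_; _∸_; _≤_; _<_; _>_; _≤′_; ≤′-refl; ≤′-step; z≤n; s≤s; s≤s⁻¹; z<s; _≤?_; _<?_)
open import Data.Nat.Properties
open import Data.Product using (Σ; ∃; _×_; _,_; proj₁; proj₂)
open import Data.Sum using (_⊎_; inj₁; inj₂; [_,_]; [_,_]′)
import Data.Sum as Sum
open import Data.Unit using (⊤; tt)
open import Function using (_∘_; id; const)
open import Function.Bundles using (Bijection; _⇔_; mk⇔; module Equivalence)
open import Function.Construct.Composition using (_⇔-∘_)
open import Function.Definitions using (Injective; Surjective)
open import Relation.Nullary using (¬_; Dec; yes; no; does; contradiction)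
open import Relation.Nullary.Decidable using (dec-true; _×-dec_; _⊎-dec_; ¬?)
open import Relation.Binary.Bundles using (Setoid)
open import Relation.Binary.PropositionalEquality using (_≡_; refl; sym; trans; cong; cong₂; subst; module ≡-Reasoning)

open Equivalence using (to; from)

does≡true⇔ : ∀ {A : Set} (a? : Dec A) → does a? ≡ true ⇔ A
does≡true⇔ a? = mk⇔ (sound a?) (dec-true a?)
  where
  sound : ∀ {A : Set} (a? : Dec A) → does a? ≡ true → A
  sound (yes a) _  = a
  sound (no _)  ()

count : (ℕ → Bool) → ℕ → ℕ
count f zero    = 0
count f (suc j) = if f (suc j) then suc (count f j) else count f j

count≤ : ∀ f j → count f j ≤ j
count≤ f zero = z≤n
count≤ f (suc j) with f (suc j)
... | true  = s≤s (count≤ f j)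
... | false = m≤n⇒m≤1+n (count≤ f j)

count-cong : ∀ {f g} j → (∀ b → f b ≡ g b) → count f j ≡ count g j
count-cong zero    _   = refl
count-cong (suc j) f≗g rewrite f≗g (suc j) | count-cong j f≗g = refl

count-mono : ∀ {f g} j → (∀ {b} → 1 ≤ b → b ≤ j → f b ≡ true → g b ≡ true) → count f j ≤ count g j
count-mono zero _ = z≤n
count-mono {f} {g} (suc j) f⇒g
  with f (suc j) in f1+j | g (suc j) in g1+j | count-mono j (λ 1≤b b≤j → f⇒g 1≤b (m≤n⇒m≤1+n b≤j))
... | true  | true  | ih = s≤s ih
... | true  | false | _  = contradiction (trans (sym (f⇒g z<s ≤-refl f1+j)) g1+j) λ ()
... | false | true  | ih = m≤n⇒m≤1+n ih
... | false | false | ih = ih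

count-suc-true : ∀ {f} j → f (suc j) ≡ true → count f (suc j) ≡ suc (count f j)
count-suc-true _ f1+j rewrite f1+j = refl

ThresholdOn : ℕ → (ℕ → Bool) → ℕ → Set
ThresholdOn j f t = ∀ {b} → 1 ≤ b → b ≤ j → f b ≡ true ⇔ t < b

UpwardClosedOn : ℕ → (ℕ → Bool) → Set
UpwardClosedOn j f = ∀ {b b'} → b ≤ b' → b' ≤ j → f b ≡ true → f b' ≡ true

count-threshold : ∀ {f t} j → ThresholdOn j f t → count f j ≡ j ∸ t
count-threshold {t = t} zero _ = sym (0∸n≡0 t)
count-threshold {f} {t} (suc j) threshold
  with f (suc j) in f1+j | count-threshold j (λ 1≤b b≤j → threshold 1≤b (m≤n⇒m≤1+n b≤j))
... | true  | ih = begin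
  suc (count f j) ≡⟨ cong suc ih ⟩
  suc (j ∸ t)     ≡⟨ sym (+-∸-assoc 1 (s≤s⁻¹ (to (threshold z<s ≤-refl) f1+j))) ⟩
  suc j ∸ t       ∎
  where open ≡-Reasoning
... | false | ih = trans ih (trans (m≤n⇒m∸n≡0 (<⇒≤ 1+j≤t)) (sym (m≤n⇒m∸n≡0 1+j≤t)))
  where
  1+j≤t : suc j ≤ t
  1+j≤t = ≮⇒≥ λ t<1+j → contradiction (trans (sym (from (threshold z<s ≤-refl) t<1+j)) f1+j) λ ()

upwardClosed⇒threshold : ∀ {f} j → UpwardClosedOn j f → ∃ λ t → t ≤ j × ThresholdOn j f t
upwardClosed⇒threshold zero _ = 0 , z≤n , λ { (s≤s _) () }
upwardClosed⇒threshold {f} (suc j) up with f (suc j) in f1+j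
... | false = suc j , ≤-refl , λ _ b≤1+j →
  mk⇔ (λ fb → contradiction (trans (sym (up b≤1+j ≤-refl fb)) f1+j) λ ())
      (λ 1+j<b → contradiction b≤1+j (<⇒≱ 1+j<b))
... | true with upwardClosed⇒threshold j (λ b≤b' b'≤j → up b≤b' (m≤n⇒m≤1+n b'≤j))
...   | t , t≤j , threshold = t , m≤n⇒m≤1+n t≤j , threshold′
  where
  threshold′ : ThresholdOn (suc j) f t
  threshold′ 1≤b b≤1+j with m≤n⇒m<n∨m≡n b≤1+j
  ... | inj₁ (s≤s b≤j) = threshold 1≤b b≤j
  ... | inj₂ refl      = mk⇔ (const (s≤s t≤j)) (const f1+j)

∸<⇒0< : ∀ {j k b} → j ∸ k < b → b ≤ j → 0 < k
∸<⇒0< {k = zero}  j<b b≤j = contradiction b≤j (<⇒≱ j<b)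
∸<⇒0< {k = suc _} _   _   = z<s

<∸1⇒2+≤ : ∀ {r} n → r < n ∸ 1 → 2 + r ≤ n
<∸1⇒2+≤ zero    ()
<∸1⇒2+≤ (suc _) r<n = s≤s r<n

2+≤⇒<∸1 : ∀ {r} n → 2 + r ≤ n → r < n ∸ 1
2+≤⇒<∸1 (suc _) (s≤s 1+r≤n) = 1+r≤n

≼F-refl : ∀ {n} (x : Gd n) → x ≼F x
≼F-refl emp            = emp≼
≼F-refl (pair _ _ _ _) = pair≼ ≤-refl ≤-refl

module Construction (n : ℕ) where

  m : ℕ
  m = n ∸ 1

  InDom⇒2+r≤n : ∀ {r j} → InDom m r j → 2 + r ≤ n
  InDom⇒2+r≤n (_ , _ , r<m) = <∸1⇒2+≤ n r<m

  InDom⇒1+j≤n : ∀ {r j} → InDom m r j → suc j ≤ n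
  InDom⇒1+j≤n dom@(_ , j≤r , _) = ≤-trans (s≤s (m≤n⇒m≤1+n j≤r)) (InDom⇒2+r≤n dom)

  pair-≡ : ∀ {a b c d p q p' q'} → a ≡ c → b ≡ d → pair {n} a b p q ≡ pair c d p' q'
  pair-≡ refl refl = cong₂ (pair _ _) (<-irrelevant _ _) (≤-irrelevant _ _)

  element : ℕ → ℕ → Gd n
  element a b with b <? a | a ≤? n
  ... | yes b<a | yes a≤n = pair a b b<a a≤n
  ... | _       | _       = emp

  element-pair : ∀ {a b} (b<a : b < a) (a≤n : a ≤ n) → element a b ≡ pair a b b<a a≤n
  element-pair {a} {b} b<a a≤n with b <? a | a ≤? n
  ... | yes _  | yes _  = pair-≡ refl refl
  ... | no b≮a | _      = contradiction b<a b≮a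
  ... | yes _  | no a≰n = contradiction a≤n a≰n

  -- Row r of the triangle belongs to the singleton {r + 2}, column j to the sets
  -- {b, j + 1} with 1 ≤ b ≤ j.
  comparisons : Rel₂ n → ℕ → ℕ → ℕ → Bool
  comparisons P r j b = P (element (2 + r) 0) (element (suc j) b)

  triangle : Rel₂ n → ℕ → ℕ → ℕ
  triangle P r j = count (comparisons P r j) j

  triangle-cong : ∀ {P Q} → (∀ x y → P x y ≡ Q x y) → ∀ r j → triangle P r j ≡ triangle Q r j
  triangle-cong P≗Q r j = count-cong j (λ _ → P≗Q _ _)

  comparisons-pair : ∀ P {r j b} (2+r≤n : 2 + r ≤ n) (b<1+j : b < suc j) (1+j≤n : suc j ≤ n) →
    comparisons P r j b ≡ P (pair (2 + r) 0 z<s 2+r≤n) (pair (suc j) b b<1+j 1+j≤n)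
  comparisons-pair P 2+r≤n b<1+j 1+j≤n = cong₂ P (element-pair z<s 2+r≤n) (element-pair b<1+j 1+j≤n)

  module _ (K : ℕ → ℕ → ℕ) where

    -- {i} lies below {b, a}: forced when i ≤ a, and for i = r + 2 > a = j + 1
    -- true exactly for the K(r, j) largest b ≤ j.
    Below : ℕ → ℕ → ℕ → Set
    Below zero          _       _ = ⊤
    Below (suc zero)    _       _ = ⊤
    Below (suc (suc r)) zero    _ = ⊤
    Below (suc (suc r)) (suc j) b = r < j ⊎ j ∸ K r j < b

    Below? : ∀ i a b → Dec (Below i a b)
    Below? zero          _       _ = yes tt
    Below? (suc zero)    _       _ = yes tt
    Below? (suc (suc r)) zero    _ = yes tt
    Below? (suc (suc r)) (suc j) b = r <? j ⊎-dec j ∸ K r j <? b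

    Below-intro : ∀ {r j b} → (j ≤ r → j ∸ K r j < b) → Below (2 + r) (suc j) b
    Below-intro {r} {j} threshold with r <? j
    ... | yes r<j = inj₁ r<j
    ... | no r≮j  = inj₂ (threshold (≮⇒≥ r≮j))

    Below-elim : ∀ {r j b} → Below (2 + r) (suc j) b → j ≤ r → j ∸ K r j < b
    Below-elim below j≤r = [ (λ r<j → contradiction j≤r (<⇒≱ r<j)) , id ] below

    ≤⇒Below : ∀ {i a b} → i ≤ a → Below i a b
    ≤⇒Below {zero}        _           = tt
    ≤⇒Below {suc zero}    _           = tt
    ≤⇒Below {suc (suc r)} (s≤s 1+r≤j) = inj₁ 1+r≤j

    ¬Below⇒< : ∀ {i a b} → ¬ Below i a b → a < i
    ¬Below⇒< ¬below = ≰⇒> (¬below ∘ ≤⇒Below)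

    Through : ℕ → ℕ → ℕ → ℕ → Set
    Through a b c d = ∃ λ i → i < suc n × ¬ Below i a b × Below i c d

    _⊑_ : Gd n → Gd n → Set
    emp                ⊑ _                  = ⊤
    pair _ _ _ _       ⊑ emp                = ⊥
    pair a zero _ _    ⊑ pair c zero _ _    = a ≤ c
    pair i zero _ _    ⊑ pair c (suc d) _ _ = Below i c (suc d)
    pair a (suc b) _ _ ⊑ pair i zero _ _    = ¬ Below i a (suc b)
    pair a (suc b) _ _ ⊑ pair c (suc d) _ _ = a ≤ c × b ≤ d ⊎ Through a (suc b) c (suc d)

    _⊑?_ : ∀ x y → Dec (x ⊑ y)
    emp                ⊑? _                  = yes tt
    pair _ _ _ _       ⊑? emp                = no λ ()
    pair a zero _ _    ⊑? pair c zero _ _    = a ≤? c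
    pair i zero _ _    ⊑? pair c (suc d) _ _ = Below? i c (suc d)
    pair a (suc b) _ _ ⊑? pair i zero _ _    = ¬? (Below? i a (suc b))
    pair a (suc b) _ _ ⊑? pair c (suc d) _ _ =
      a ≤? c ×-dec b ≤? d ⊎-dec anyUpTo? (λ i → ¬? (Below? i a (suc b)) ×-dec Below? i c (suc d)) (suc n)

    order : Rel₂ n
    order x y = does (x ⊑? y)

    order⇒⊑ : ∀ x y → order x y ≡ true → x ⊑ y
    order⇒⊑ x y = to (does≡true⇔ (x ⊑? y))

    ⊑⇒order : ∀ x y → x ⊑ y → order x y ≡ true
    ⊑⇒order x y = from (does≡true⇔ (x ⊑? y))

    ≼⇒⊑ : ∀ {x y} → x ≼F y → x ⊑ y
    ≼⇒⊑ {emp}                                   emp≼                   = tt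
    ≼⇒⊑ {pair _ zero _ _}    {pair _ zero _ _}    (pair≼ a≤c _)          = a≤c
    ≼⇒⊑ {pair _ zero _ _}    {pair _ (suc _) _ _} (pair≼ a≤c _)          = ≤⇒Below a≤c
    ≼⇒⊑ {pair _ (suc _) _ _} {pair _ zero _ _}    (pair≼ _ ())
    ≼⇒⊑ {pair _ (suc _) _ _} {pair _ (suc _) _ _} (pair≼ a≤c (s≤s b≤d)) = inj₁ (a≤c , b≤d)

    singleton-comparable : ∀ i (0<i : 0 < i) (i≤n : i ≤ n) y → pair i 0 0<i i≤n ⊑ y ⊎ y ⊑ pair i 0 0<i i≤n
    singleton-comparable i _ _ emp                = inj₂ tt
    singleton-comparable i _ _ (pair c zero _ _)  = ≤-total i c
    singleton-comparable i _ _ (pair c (suc d) _ _) with Below? i c (suc d)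
    ... | yes below = inj₁ below
    ... | no ¬below = inj₂ ¬below

    AgreesOnSingletons : Rel₂ n → Set
    AgreesOnSingletons Q = ∀ {i a b} (0<i : 0 < i) (i≤n : i ≤ n) (1+b<a : suc b < a) (a≤n : a ≤ n) →
      Q (pair i 0 0<i i≤n) (pair a (suc b) 1+b<a a≤n) ≡ true ⇔ Below i a (suc b)

    ⊑-least : ∀ {Q} → Admissible Q → AgreesOnSingletons Q → ∀ x y → x ⊑ y → Q x y ≡ true
    ⊑-least {Q} (isPartialOrder , refines , comparable) agrees = least
      where
      open IsPartialOrder isPartialOrder

      pair⊑singleton : ∀ {a b i} (1+b<a : suc b < a) (a≤n : a ≤ n) (0<i : 0 < i) (i≤n : i ≤ n) →
        ¬ Below i a (suc b) → Q (pair a (suc b) 1+b<a a≤n) (pair i 0 0<i i≤n) ≡ true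
      pair⊑singleton 1+b<a a≤n 0<i i≤n ¬below with comparable _ 0<i i≤n (pair _ _ 1+b<a a≤n)
      ... | inj₁ S≤X = contradiction (to (agrees 0<i i≤n 1+b<a a≤n) S≤X) ¬below
      ... | inj₂ X≤S = X≤S

      least : ∀ x y → x ⊑ y → Q x y ≡ true
      least emp y _ = refines emp y emp≼
      least (pair _ _ _ _) emp ()
      least (pair _ zero _ _) (pair _ zero _ _) a≤c = refines _ _ (pair≼ a≤c z≤n)
      least (pair _ zero 0<i i≤n) (pair _ (suc _) 1+d<c c≤n) below = from (agrees 0<i i≤n 1+d<c c≤n) below
      least (pair _ (suc _) 1+b<a a≤n) (pair _ zero 0<i i≤n) ¬below = pair⊑singleton 1+b<a a≤n 0<i i≤n ¬below
      least (pair _ (suc _) _ _) (pair _ (suc _) _ _) (inj₁ (a≤c , b≤d)) = refines _ _ (pair≼ a≤c (s≤s b≤d))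
      least (pair _ (suc _) 1+b<a a≤n) (pair _ (suc _) 1+d<c c≤n) (inj₂ (i , i<1+n , ¬below , below)) =
        trans' _ (pair i 0 0<i i≤n) _
          (pair⊑singleton 1+b<a a≤n 0<i i≤n ¬below) (from (agrees 0<i i≤n 1+d<c c≤n) below)
        where
        i≤n : i ≤ n
        i≤n = s≤s⁻¹ i<1+n
        0<i : 0 < i
        0<i = m<n⇒0<n (¬Below⇒< ¬below)

    ⊆order⇒agrees : ∀ {Q} → Admissible Q → Q ⊆R order → AgreesOnSingletons Q
    ⊆order⇒agrees (_ , _ , comparable) Q⊆order {i} {a} {b} 0<i i≤n 1+b<a a≤n =
      mk⇔ (order⇒⊑ S X ∘ Q⊆order S X)
          (λ below → [ id , (λ X≤S → contradiction below (order⇒⊑ X S (Q⊆order X S X≤S))) ]′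
                       (comparable i 0<i i≤n X))
      where
      S X : Gd n
      S = pair i 0 0<i i≤n
      X = pair a (suc b) 1+b<a a≤n

    module _ (kagog : IsKagog m K) where
      open IsKagog kagog

      column-antitone : ∀ {r r' j} → InDom m r j → r ≤′ r' → r' < m → K r' j ≤ K r j
      column-antitone _ ≤′-refl _ = ≤-refl
      column-antitone {r} {suc r''} {j} dom@(1≤j , j≤r , _) (≤′-step r≤′r'') 1+r''<m =
        ≤-trans (colDecr r'' j (1≤j , j≤r'' , <⇒≤ 1+r''<m) (1≤j , m≤n⇒m≤1+n j≤r'' , 1+r''<m))
                (column-antitone dom r≤′r'' (<⇒≤ 1+r''<m))
        where
        j≤r'' : j ≤ r''
        j≤r'' = ≤-trans j≤r (≤′⇒≤ r≤′r'')

      row-shift : ∀ {r j j' b} → InDom m r j → j ≤′ j' → j' ≤ r → b ≤ j →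
        j ∸ K r j < b → j' ∸ K r j' < b
      row-shift _ ≤′-refl _ _ below = below
      row-shift {r} {j} {suc j''} {b} dom@(1≤j , _ , r<m) (≤′-step j≤′j'') 1+j''≤r b≤j below =
        ≤-<-trans (∸-monoʳ-≤ (suc j'') (rowIncr r j'' dom'' (∸<⇒0< below'' (≤-trans b≤j j≤j'')) 1+j''≤r))
                  below''
        where
        j≤j'' : j ≤ j''
        j≤j'' = ≤′⇒≤ j≤′j''
        dom'' : InDom m r j''
        dom'' = ≤-trans 1≤j j≤j'' , <⇒≤ 1+j''≤r , r<m
        below'' : j'' ∸ K r j'' < b
        below'' = row-shift dom j≤′j'' (<⇒≤ 1+j''≤r) b≤j below

      Below-antitone : ∀ {i i' a b} → i ≤ i' → i' ≤ n → suc b < a → Below i' a (suc b) → Below i a (suc b)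
      Below-antitone {zero}        _ _ _ _ = tt
      Below-antitone {suc zero}    _ _ _ _ = tt
      Below-antitone {suc (suc r)} {suc (suc r')} (s≤s (s≤s r≤r')) 2+r'≤n (s≤s 1+b≤j) below =
        Below-intro λ j≤r → ≤-<-trans
          (∸-monoʳ-≤ _ (column-antitone (≤-trans z<s 1+b≤j , j≤r , ≤-<-trans r≤r' r'<m) (≤⇒≤′ r≤r') r'<m))
          (Below-elim below (≤-trans j≤r r≤r'))
        where
        r'<m : r' < m
        r'<m = 2+≤⇒<∸1 n 2+r'≤n

      Below-mono : ∀ {i a b c d} → a ≤ c → b ≤ d → suc b < a → i ≤ n →
        Below i a (suc b) → Below i c (suc d)
      Below-mono {zero}        _ _ _ _ _ = tt
      Below-mono {suc zero}    _ _ _ _ _ = tt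
      Below-mono {suc (suc r)} (s≤s j≤j') b≤d (s≤s 1+b≤j) 2+r≤n below =
        Below-intro λ j'≤r → <-≤-trans
          (row-shift (≤-trans z<s 1+b≤j , ≤-trans j≤j' j'≤r , 2+≤⇒<∸1 n 2+r≤n) (≤⇒≤′ j≤j') j'≤r 1+b≤j
                     (Below-elim below (≤-trans j≤j' j'≤r)))
          (s≤s b≤d)

      Below-separates : ∀ {i e a b} → i ≤ n → suc b < a → Below i a (suc b) → ¬ Below e a (suc b) → i < e
      Below-separates i≤n 1+b<a below ¬below = ≰⇒> λ e≤i → ¬below (Below-antitone e≤i i≤n 1+b<a below)

      ⊑-antisym : ∀ x y → x ⊑ y → y ⊑ x → x ≡ y
      ⊑-antisym emp emp _ _ = refl
      ⊑-antisym emp (pair _ _ _ _) _ ()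
      ⊑-antisym (pair _ _ _ _) emp ()
      ⊑-antisym (pair _ zero _ _) (pair _ zero _ _) a≤c c≤a = pair-≡ (≤-antisym a≤c c≤a) refl
      ⊑-antisym (pair _ zero _ _) (pair _ (suc _) _ _) below ¬below = contradiction below ¬below
      ⊑-antisym (pair _ (suc _) _ _) (pair _ zero _ _) ¬below below = contradiction below ¬below
      ⊑-antisym (pair _ (suc _) 1+b<a _) (pair _ (suc _) 1+d<c _) X⊑Y Y⊑X with X⊑Y | Y⊑X
      ... | inj₁ (a≤c , b≤d) | inj₁ (c≤a , d≤b) = pair-≡ (≤-antisym a≤c c≤a) (cong suc (≤-antisym b≤d d≤b))
      ... | inj₁ (a≤c , b≤d) | inj₂ (i , i<1+n , ¬belowY , belowX) =
        contradiction (Below-mono a≤c b≤d 1+b<a (s≤s⁻¹ i<1+n) belowX) ¬belowY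
      ... | inj₂ (i , i<1+n , ¬belowX , belowY) | inj₁ (c≤a , d≤b) =
        contradiction (Below-mono c≤a d≤b 1+d<c (s≤s⁻¹ i<1+n) belowY) ¬belowX
      ... | inj₂ (i , i<1+n , ¬belowX , belowY) | inj₂ (k , k<1+n , ¬belowY , belowX) =
        contradiction (Below-separates (s≤s⁻¹ i<1+n) 1+d<c belowY ¬belowY)
                      (<-asym (Below-separates (s≤s⁻¹ k<1+n) 1+b<a belowX ¬belowX))

      ⊑-trans : ∀ x y z → x ⊑ y → y ⊑ z → x ⊑ z
      ⊑-trans emp _ _ _ _ = tt
      ⊑-trans (pair _ _ _ _) emp _ () _
      ⊑-trans (pair _ _ _ _) (pair _ _ _ _) emp _ ()
      ⊑-trans (pair _ zero _ _) (pair _ zero _ _) (pair _ zero _ _) a≤c c≤e = ≤-trans a≤c c≤e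
      ⊑-trans (pair _ zero _ _) (pair _ zero _ c≤n) (pair _ (suc _) 1+f<e _) a≤c belowZ =
        Below-antitone a≤c c≤n 1+f<e belowZ
      ⊑-trans (pair _ zero _ a≤n) (pair _ (suc _) 1+d<c _) (pair _ zero _ _) belowY ¬belowY =
        <⇒≤ (Below-separates a≤n 1+d<c belowY ¬belowY)
      ⊑-trans (pair _ zero _ a≤n) (pair _ (suc _) 1+d<c _) (pair _ (suc _) 1+f<e _) belowY Y⊑Z with Y⊑Z
      ... | inj₁ (c≤e , d≤f) = Below-mono c≤e d≤f 1+d<c a≤n belowY
      ... | inj₂ (k , k<1+n , ¬belowY , belowZ) =
        Below-antitone (<⇒≤ (Below-separates a≤n 1+d<c belowY ¬belowY)) (s≤s⁻¹ k<1+n) 1+f<e belowZ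
      ⊑-trans (pair _ (suc _) 1+b<a _) (pair _ zero _ _) (pair _ zero _ e≤n) ¬belowX c≤e =
        ¬belowX ∘ Below-antitone c≤e e≤n 1+b<a
      ⊑-trans (pair _ (suc _) _ _) (pair c zero _ c≤n) (pair _ (suc _) _ _) ¬belowX belowZ =
        inj₂ (c , s≤s c≤n , ¬belowX , belowZ)
      ⊑-trans (pair _ (suc _) 1+b<a _) (pair _ (suc _) 1+d<c _) (pair _ zero _ e≤n) X⊑Y ¬belowY with X⊑Y
      ... | inj₁ (a≤c , b≤d) = ¬belowY ∘ Below-mono a≤c b≤d 1+b<a e≤n
      ... | inj₂ (k , k<1+n , ¬belowX , belowY) =
        ¬belowX ∘ Below-antitone (<⇒≤ (Below-separates (s≤s⁻¹ k<1+n) 1+d<c belowY ¬belowY)) e≤n 1+b<a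
      ⊑-trans (pair _ (suc _) 1+b<a _) (pair _ (suc _) 1+d<c _) (pair _ (suc _) _ _) X⊑Y Y⊑Z with X⊑Y | Y⊑Z
      ... | inj₁ (a≤c , b≤d) | inj₁ (c≤e , d≤f) = inj₁ (≤-trans a≤c c≤e , ≤-trans b≤d d≤f)
      ... | inj₁ (a≤c , b≤d) | inj₂ (k , k<1+n , ¬belowY , belowZ) =
        inj₂ (k , k<1+n , ¬belowY ∘ Below-mono a≤c b≤d 1+b<a (s≤s⁻¹ k<1+n) , belowZ)
      ... | inj₂ (k , k<1+n , ¬belowX , belowY) | inj₁ (c≤e , d≤f) =
        inj₂ (k , k<1+n , ¬belowX , Below-mono c≤e d≤f 1+d<c (s≤s⁻¹ k<1+n) belowY)
      ... | inj₂ (k , k<1+n , ¬belowX , belowY) | inj₂ (l , l<1+n , ¬belowY , belowZ) =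
        inj₂ (l , l<1+n , ¬belowX ∘ Below-antitone k≤l (s≤s⁻¹ l<1+n) 1+b<a , belowZ)
        where
        k≤l : k ≤ l
        k≤l = <⇒≤ (Below-separates (s≤s⁻¹ k<1+n) 1+d<c belowY ¬belowY)

      order-admissible : Admissible order
      order-admissible =
        isPartialOrder ,
        (λ x y → ⊑⇒order x y ∘ ≼⇒⊑) ,
        λ i 0<i i≤n y → Sum.map (⊑⇒order (pair i 0 0<i i≤n) y) (⊑⇒order y (pair i 0 0<i i≤n))
                                (singleton-comparable i 0<i i≤n y)
        where
        isPartialOrder : IsPartialOrder order
        isPartialOrder = record
          { refl'   = λ x → ⊑⇒order x x (≼⇒⊑ (≼F-refl x))
          ; antisym = λ x y x⊑y y⊑x → ⊑-antisym x y (order⇒⊑ x y x⊑y) (order⇒⊑ y x y⊑x)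
          ; trans'  = λ x y z x⊑y y⊑z →
                        ⊑⇒order x z (⊑-trans x y z (order⇒⊑ x y x⊑y) (order⇒⊑ y z y⊑z))
          }

      order-isF1 : IsF1 order
      order-isF1 = order-admissible , λ Q Q-admissible Q⊆order x y →
        ⊑-least Q-admissible (⊆order⇒agrees Q-admissible Q⊆order) x y ∘ order⇒⊑ x y

      F1-determined : ∀ {P} → IsF1 P → AgreesOnSingletons P → ∀ x y → P x y ≡ order x y
      F1-determined (admissible , minimal) agrees x y =
        ⇔→≡ (mk⇔ (minimal order order-admissible order⊆P x y) (order⊆P x y))
        where
        order⊆P : order ⊆R _
        order⊆P x y = ⊑-least admissible agrees x y ∘ order⇒⊑ x y

      triangle-order : ∀ {r j} → InDom m r j → triangle order r j ≡ K r j
      triangle-order {r} {j} dom@(_ , j≤r , _) = begin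
        triangle order r j  ≡⟨ count-threshold j threshold ⟩
        j ∸ (j ∸ K r j)     ≡⟨ m∸[m∸n]≡n (bound r j dom) ⟩
        K r j               ∎
        where
        open ≡-Reasoning
        threshold : ThresholdOn j (comparisons order r j) (j ∸ K r j)
        threshold {suc b} _ 1+b≤j
          rewrite comparisons-pair order (InDom⇒2+r≤n dom) (s≤s 1+b≤j) (InDom⇒1+j≤n dom) =
          mk⇔ (λ below → Below-elim below j≤r) (Below-intro ∘ const)
            ⇔-∘ does≡true⇔ (Below? (2 + r) (suc j) (suc b))

  Below-cong : ∀ {K K'} → (∀ r j → InDom m r j → K r j ≡ K' r j) →
    ∀ {i a b} → i ≤ n → suc b < a → Below K i a (suc b) → Below K' i a (suc b)
  Below-cong _     {zero}        _ _ _ = tt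
  Below-cong _     {suc zero}    _ _ _ = tt
  Below-cong {K} {K'} K≗K' {suc (suc r)} {suc j} {b} 2+r≤n (s≤s 1+b≤j) below = Below-intro K' λ j≤r →
    subst (λ k → j ∸ k < suc b) (K≗K' r j (≤-trans z<s 1+b≤j , j≤r , 2+≤⇒<∸1 n 2+r≤n)) (Below-elim K below j≤r)

  agrees-cong : ∀ {K K' Q} → (∀ r j → InDom m r j → K r j ≡ K' r j) →
    AgreesOnSingletons K Q → AgreesOnSingletons K' Q
  agrees-cong K≗K' agrees 0<i i≤n 1+b<a a≤n =
    mk⇔ (Below-cong K≗K' i≤n 1+b<a) (Below-cong (λ r j dom → sym (K≗K' r j dom)) i≤n 1+b<a)
      ⇔-∘ agrees 0<i i≤n 1+b<a a≤n

  module _ {P : Rel₂ n} (admissible : Admissible P) where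
    open IsPartialOrder (proj₁ admissible)

    refines : Refines P
    refines = proj₁ (proj₂ admissible)

    comparisons-mono : ∀ {r r' j j' b b'} → r' ≤ r → j ≤ j' → b ≤ b' → b ≤ j → b' ≤ j' →
      2 + r ≤ n → suc j' ≤ n → comparisons P r j b ≡ true → comparisons P r' j' b' ≡ true
    comparisons-mono r'≤r j≤j' b≤b' b≤j b'≤j' 2+r≤n 1+j'≤n below =
      trans (comparisons-pair P (≤-trans (s≤s (s≤s r'≤r)) 2+r≤n) (s≤s b'≤j') 1+j'≤n)
        (trans' _ _ _ (refines _ _ (pair≼ (s≤s (s≤s r'≤r)) z≤n))
          (trans' _ _ _ (trans (sym (comparisons-pair P 2+r≤n (s≤s b≤j) (≤-trans (s≤s j≤j') 1+j'≤n))) below)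
            (refines _ _ (pair≼ (s≤s j≤j') b≤b'))))

    row-upwardClosed : ∀ {r j} → 2 + r ≤ n → suc j ≤ n → UpwardClosedOn j (comparisons P r j)
    row-upwardClosed 2+r≤n 1+j≤n b≤b' b'≤j = comparisons-mono ≤-refl ≤-refl b≤b' (≤-trans b≤b' b'≤j) b'≤j 2+r≤n 1+j≤n

    row-threshold : ∀ {r j} → 2 + r ≤ n → suc j ≤ n → ThresholdOn j (comparisons P r j) (j ∸ triangle P r j)
    row-threshold {r} {j} 2+r≤n 1+j≤n with upwardClosed⇒threshold j (row-upwardClosed 2+r≤n 1+j≤n)
    ... | t , t≤j , threshold = subst (ThresholdOn j (comparisons P r j)) (sym t≡j∸K) threshold
      where
      t≡j∸K : j ∸ triangle P r j ≡ t
      t≡j∸K = trans (cong (j ∸_) (count-threshold j threshold)) (m∸[m∸n]≡n t≤j)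

    triangle-isKagog : IsKagog m (triangle P)
    triangle-isKagog = record { bound = λ r j _ → count≤ _ j ; colDecr = colDecr ; rowIncr = rowIncr }
      where
      colDecr : ∀ r j → InDom m r j → InDom m (suc r) j → triangle P (suc r) j ≤ triangle P r j
      colDecr r j _ dom' = count-mono j λ _ b≤j →
        comparisons-mono (n≤1+n r) ≤-refl ≤-refl b≤j b≤j (InDom⇒2+r≤n dom') (InDom⇒1+j≤n dom')

      rowIncr : ∀ r j → InDom m r j → triangle P r j > 0 → j < r → triangle P r (suc j) > triangle P r j
      rowIncr r j dom@(1≤j , _ , _) 0<K j<r = begin-strict
        triangle P r j                    ≤⟨ count-mono j (λ _ b≤j → row-mono b≤j) ⟩
        count (comparisons P r (suc j)) j <⟨ ≤-reflexive (sym (count-suc-true j top)) ⟩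
        triangle P r (suc j)              ∎
        where
        open ≤-Reasoning
        2+r≤n : 2 + r ≤ n
        2+r≤n = InDom⇒2+r≤n dom
        2+j≤n : 2 + j ≤ n
        2+j≤n = ≤-trans (s≤s (m≤n⇒m≤1+n j<r)) 2+r≤n
        row-mono : ∀ {b} → b ≤ j → comparisons P r j b ≡ true → comparisons P r (suc j) b ≡ true
        row-mono b≤j = comparisons-mono ≤-refl (n≤1+n j) ≤-refl b≤j (m≤n⇒m≤1+n b≤j) 2+r≤n 2+j≤n
        top : comparisons P r (suc j) (suc j) ≡ true
        top = comparisons-mono ≤-refl (n≤1+n j) (n≤1+n j) ≤-refl ≤-refl 2+r≤n 2+j≤n
          (from (row-threshold 2+r≤n (InDom⇒1+j≤n dom) 1≤j ≤-refl) (∸-monoʳ-< 0<K (count≤ _ j)))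

    triangle-agrees : AgreesOnSingletons (triangle P) P
    triangle-agrees {zero} () _ _ _
    triangle-agrees {suc zero} _ _ 1+b<a _ = mk⇔ (const tt) (const (refines _ _ (pair≼ (m<n⇒0<n 1+b<a) z≤n)))
    triangle-agrees {suc (suc r)} {suc j} {b} (s≤s z≤n) 2+r≤n (s≤s 1+b≤j) 1+j≤n with r <? j
    ... | yes r<j = mk⇔ (const (inj₁ r<j)) (const (refines _ _ (pair≼ (s≤s r<j) z≤n)))
    ... | no r≮j rewrite sym (comparisons-pair P 2+r≤n (s≤s 1+b≤j) 1+j≤n) =
      mk⇔ (Below-intro (triangle P) ∘ const) (λ below → Below-elim (triangle P) below (≮⇒≥ r≮j))
        ⇔-∘ row-threshold 2+r≤n 1+j≤n z<s 1+b≤j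

  toTriangle : Σ (Rel₂ n) IsF1 → Σ (ℕ → ℕ → ℕ) (IsKagog m)
  toTriangle (P , isF1) = triangle P , triangle-isKagog (proj₁ isF1)

  toTriangle-injective : Injective (Setoid._≈_ (F1Setoid n)) (Setoid._≈_ (KagogSetoid m)) toTriangle
  toTriangle-injective {P , P-isF1} {Q , Q-isF1} same x y = begin
    P x y        ≡⟨ F1-determined K kagog P-isF1 (triangle-agrees (proj₁ P-isF1)) x y ⟩
    order K x y  ≡⟨ F1-determined K kagog Q-isF1 Q-agrees x y ⟨
    Q x y        ∎
    where
    open ≡-Reasoning
    K : ℕ → ℕ → ℕ
    K = triangle P
    kagog : IsKagog m K
    kagog = triangle-isKagog (proj₁ P-isF1)
    Q-agrees : AgreesOnSingletons K Q
    Q-agrees = agrees-cong {Q = Q} (λ r j dom → sym (same r j dom)) (triangle-agrees (proj₁ Q-isF1))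

  toTriangle-surjective : Surjective (Setoid._≈_ (F1Setoid n)) (Setoid._≈_ (KagogSetoid m)) toTriangle
  toTriangle-surjective (K , kagog) =
    (order K , order-isF1 K kagog) ,
    λ Q≗order r j dom → trans (triangle-cong Q≗order r j) (triangle-order K kagog dom)

mainTheorem4 : (n : ℕ) → 2 ≤ n → Bijection (F1Setoid n) (KagogSetoid (n ∸ 1))
mainTheorem4 n _ = record
  { to        = toTriangle
  ; cong      = λ P≗Q r j _ → triangle-cong P≗Q r j
  ; bijective = (λ {P Q} → toTriangle-injective {P} {Q}) , toTriangle-surjective
  }
  where open Construction n
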